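{- Let $\mathcal{N}=\langle S,A,\iota,\{p_i\}_{i\in I}\rangle$ be an acyclic MEMDP and $T\subseteq S$. If there exists a policy $\sigma$ with $\Pr_{\mathcal{N}_i}(T\mid\sigma)=1$ for all $i\in I$, then there exists a deterministic policy with this property.
   Context: An MDP is $\langle S,A,\iota,p\rangle$ with finite $S,A$, initial distribution $\iota$, total $p\colon S\times A\to\mathit{Dist}(S)$. A state $s$ is absorbing if the only state reachable from $s$ is $s$ itself; an MDP is acyclic if every state is absorbing or not reachable from any of its successor states. A MEMDP $\mathcal{N}=\langle S,A,\iota,\{p_i\}_{i\in I}\rangle$ has finite environment set $I$ and transition functions $p_i$, with $\mathcal{N}_i=\langle S,A,\iota,p_i\rangle$; it is acyclic if every $\mathcal{N}_i$ is acyclic. A policy maps finite histories $s_0a_0\dots s_n$ to distributions over $A$; it is deterministic if it always returns a Dirac distribution (i.e., it is a map from histories to $A$). $\Pr_{\mathcal{N}_i}(T\mid\sigma)$ is the probability of eventually reaching $T$ in $\mathcal{N}_i$ under $\sigma$ from $\iota$.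
   Formalization: The initial distribution ι, the transition functions $p_i$ and the action distributions of every policy, including the assumed policy σ, take values in the rationals. -}

module Defs where

open import Data.Nat using (ℕ; zero; suc)
open import Data.Fin using (Fin; _≟_)
open import Data.Fin.Subset using (Subset; _∈_)
open import Data.Fin.Subset.Properties using (_∈?_)
open import Data.List using (List; []; _∷_; _++_)
open import Data.Product using (Σ; _×_; _,_; proj₁; proj₂; ∃-syntax)
open import Data.Sum using (_⊎_)
open import Data.Rational using (ℚ; 0ℚ; 1ℚ; _+_; _*_; _-_; _≤_; _<_)
open import Relation.Binary.PropositionalEquality using (_≡_)
open import Relation.Nullary using (¬_; yes; no)

Σᶠ : ∀ {n} → (Fin n → ℚ) → ℚ
Σᶠ {zero}  f = 0ℚ
Σᶠ {suc n} f = f Fin.zero + Σᶠ (λ i → f (Fin.suc i))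

Dist : ℕ → Set
Dist n = Σ (Fin n → ℚ) (λ d → (∀ x → 0ℚ ≤ d x) × Σᶠ d ≡ 1ℚ)

diracFn : ∀ {n} → Fin n → Fin n → ℚ
diracFn a b with a ≟ b
... | yes _ = 1ℚ
... | no  _ = 0ℚ

record MDP (nS nA : ℕ) : Set where
  field
    ι : Dist nS
    p : Fin nS → Fin nA → Dist nS

record MEMDP (nS nA nI : ℕ) : Set where
  field
    ι : Dist nS
    p : Fin nI → Fin nS → Fin nA → Dist nS

  env : Fin nI → MDP nS nA
  env i = record { ι = ι ; p = p i }

module _ {nS nA : ℕ} (M : MDP nS nA) where
  open MDP M

  Succ : Fin nS → Fin nS → Set
  Succ s t = ∃[ a ] (0ℚ < proj₁ (p s a) t)

  data Reach : Fin nS → Fin nS → Set where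
    here : ∀ {s} → Reach s s
    step : ∀ {s t u} → Succ s t → Reach t u → Reach s u

  Absorbing : Fin nS → Set
  Absorbing s = ∀ t → Reach s t → t ≡ s

  AcyclicMDP : Set
  AcyclicMDP = ∀ s → Absorbing s ⊎ (∀ t → Succ s t → ¬ Reach t s)

AcyclicMEMDP : ∀ {nS nA nI} → MEMDP nS nA nI → Set
AcyclicMEMDP {nI = nI} N = ∀ (i : Fin nI) → AcyclicMDP (MEMDP.env N i)

-- Finite history s₀ a₀ s₁ a₁ … sₙ: the list of (sⱼ , aⱼ) pairs for j < n
-- (chronological order) together with the last state sₙ.
History : ℕ → ℕ → Set
History nS nA = List (Fin nS × Fin nA) × Fin nS

extend : ∀ {nS nA} → History nS nA → Fin nA → Fin nS → History nS nA
extend (xs , s) a s' = (xs ++ ((s , a) ∷ [])) , s'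

Policy : ℕ → ℕ → Set
Policy nS nA = History nS nA → Dist nA

Deterministic : ∀ {nS nA} → Policy nS nA → Set
Deterministic {nS} {nA} σ =
  Σ (History nS nA → Fin nA) (λ f → ∀ h b → proj₁ (σ h) b ≡ diracFn (f h) b)

module _ {nS nA : ℕ} (M : MDP nS nA) (T : Subset nS) (σ : Policy nS nA) where
  open MDP M

  reachWithin : ℕ → History nS nA → ℚ
  reachWithin n h with proj₂ h ∈? T
  ... | yes _ = 1ℚ
  reachWithin zero    h | no _ = 0ℚ
  reachWithin (suc n) h | no _ =
    Σᶠ (λ a → proj₁ (σ h) a *
      Σᶠ (λ s' → proj₁ (p (proj₂ h) a) s' * reachWithin n (extend h a s')))

  PrWithin : ℕ → ℚ
  PrWithin n = Σᶠ (λ s → proj₁ ι s * reachWithin n (([] , s)))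

  -- Pr_M(◇ T | σ) = 1, i.e. the (monotone, bounded by 1) sequence
  -- PrWithin n converges to 1: for every ε > 0 some PrWithin n ≥ 1 - ε.
  ReachesSurely : Set
  ReachesSurely = ∀ (ε : ℚ) → 0ℚ < ε → ∃[ n ] (1ℚ - ε ≤ PrWithin n)

{-# OPTIONS --safe #-}
-- Let σ reach T almost surely in every environment, and let τ play at each history some action
-- that σ plays there with positive probability; τ depends on σ alone, so it serves all
-- environments at once. Fix an environment and call a history good if its probability of reaching
-- T under σ tends to 1. Goodness passes along positive-probability σ-steps, because the deficit at
-- a successor is at most the parent's deficit divided by the probability of the step, and no
-- absorbing state outside T is good. Well-founded induction along the acyclic transition graph
-- then shows that from every good history all positive-probability τ-paths hit T within a bounded
-- number of steps, so τ reaches T with probability exactly 1 after finitely many steps.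
module Submission where

open import Defs
open import Data.Empty using (⊥-elim)
open import Data.Fin using (Fin; zero; suc; _≟_)
open import Data.Fin.Induction using (spo-wellFounded)
open import Data.Fin.Properties using (suc-injective)
open import Data.Fin.Subset using (Subset; _∈_; _∉_)
open import Data.Fin.Subset.Properties using (_∈?_)
open import Data.Integer using (+≤+)
open import Data.List using ([])
open import Data.Nat as ℕ using (ℕ; _⊔_; s≤s)
open import Data.Nat.Properties using (m≤m⊔n; m≤n⊔m)
open import Data.Product using (Σ; _×_; _,_; proj₁; proj₂; ∃-syntax)
open import Data.Rational using (ℚ; 0ℚ; 1ℚ; ½; _+_; _*_; _-_; -_; _≤_; _<_; _<?_; *≤*; nonNegative; positive)
import Data.Rational.Properties as ℚ
open import Data.Rational.Solver using (module +-*-Solver)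
open import Data.Sum using (_⊎_; inj₁; inj₂)
open import Function using (_∘_)
open import Induction.WellFounded using (Acc; acc; WellFounded)
open import Relation.Binary.Structures using (IsStrictPartialOrder)
open import Relation.Nullary using (¬_; yes; no; Dec)
open import Relation.Binary.PropositionalEquality

open +-*-Solver using (solve; _:+_; _:-_; _:=_; con)

0≤1 : 0ℚ ≤ 1ℚ
0≤1 = ℚ.nonNegative⁻¹ 1ℚ

*-nonNeg : ∀ {p q} → 0ℚ ≤ p → 0ℚ ≤ q → 0ℚ ≤ p * q
*-nonNeg {p} {q} 0≤p 0≤q =
  ℚ.nonNegative⁻¹ (p * q) {{ℚ.nonNeg*nonNeg⇒nonNeg p {{nonNegative 0≤p}} q {{nonNegative 0≤q}}}}

*-pos : ∀ {p q} → 0ℚ < p → 0ℚ < q → 0ℚ < p * q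
*-pos {p} {q} 0<p 0<q = ℚ.positive⁻¹ (p * q) {{ℚ.pos*pos⇒pos p {{positive 0<p}} q {{positive 0<q}}}}

*-≤1 : ∀ {p q} → 0ℚ ≤ p → p ≤ 1ℚ → q ≤ 1ℚ → p * q ≤ 1ℚ
*-≤1 {p} {q} 0≤p p≤1 q≤1 =
  ℚ.≤-trans (subst (p * q ≤_) (ℚ.*-identityʳ p) (ℚ.*-monoˡ-≤-nonNeg p {{nonNegative 0≤p}} q≤1)) p≤1

nonNeg∧¬pos⇒≡0 : ∀ {p} → 0ℚ ≤ p → ¬ (0ℚ < p) → p ≡ 0ℚ
nonNeg∧¬pos⇒≡0 0≤p p≯0 = ℚ.≤-antisym (ℚ.≮⇒≥ p≯0) 0≤p

p≤q⇒0≤q-p : ∀ {p q} → p ≤ q → 0ℚ ≤ q - p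
p≤q⇒0≤q-p {p} {q} p≤q = subst (_≤ q - p) (ℚ.+-inverseʳ p) (ℚ.+-monoˡ-≤ (- p) p≤q)

1-p≤1 : ∀ {p} → 0ℚ ≤ p → 1ℚ - p ≤ 1ℚ
1-p≤1 0≤p = ℚ.+-monoʳ-≤ 1ℚ (ℚ.neg-antimono-≤ 0≤p)

p-r≤q⇒p-q≤r : ∀ {p q r} → p - r ≤ q → p - q ≤ r
p-r≤q⇒p-q≤r {p} {q} {r} p-r≤q = subst₂ _≤_
  (solve 3 (λ p q r → (p :- r) :+ (r :- q) := p :- q) refl p q r)
  (solve 2 (λ q r → q :+ (r :- q) := r) refl q r)
  (ℚ.+-monoˡ-≤ (r - q) p-r≤q)

1-½≰0 : ¬ (1ℚ - ½ ≤ 0ℚ)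
1-½≰0 (*≤* (+≤+ ()))

Σᶠ-cong : ∀ {n} {f g : Fin n → ℚ} → (∀ x → f x ≡ g x) → Σᶠ f ≡ Σᶠ g
Σᶠ-cong {ℕ.zero} f≗g = refl
Σᶠ-cong {ℕ.suc n} f≗g = cong₂ _+_ (f≗g zero) (Σᶠ-cong (f≗g ∘ suc))

Σᶠ-mono-≤ : ∀ {n} {f g : Fin n → ℚ} → (∀ x → f x ≤ g x) → Σᶠ f ≤ Σᶠ g
Σᶠ-mono-≤ {ℕ.zero} f≤g = ℚ.≤-refl
Σᶠ-mono-≤ {ℕ.suc n} f≤g = ℚ.+-mono-≤ (f≤g zero) (Σᶠ-mono-≤ (f≤g ∘ suc))

Σᶠ-0 : ∀ n → Σᶠ {n} (λ _ → 0ℚ) ≡ 0ℚ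
Σᶠ-0 ℕ.zero = refl
Σᶠ-0 (ℕ.suc n) = cong (0ℚ +_) (Σᶠ-0 n)

Σᶠ-nonNeg : ∀ {n} {f : Fin n → ℚ} → (∀ x → 0ℚ ≤ f x) → 0ℚ ≤ Σᶠ f
Σᶠ-nonNeg {n} {f} 0≤f = subst (_≤ Σᶠ f) (Σᶠ-0 n) (Σᶠ-mono-≤ 0≤f)

Σᶠ-distrib-+ : ∀ {n} (f g : Fin n → ℚ) → Σᶠ (λ x → f x + g x) ≡ Σᶠ f + Σᶠ g
Σᶠ-distrib-+ {ℕ.zero} f g = refl
Σᶠ-distrib-+ {ℕ.suc n} f g = begin
  (f zero + g zero) + Σᶠ (λ x → f (suc x) + g (suc x)) ≡⟨ cong ((f zero + g zero) +_) (Σᶠ-distrib-+ (f ∘ suc) (g ∘ suc)) ⟩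
  (f zero + g zero) + (Σᶠ (f ∘ suc) + Σᶠ (g ∘ suc))    ≡⟨ solve 4 (λ a b c d → (a :+ b) :+ (c :+ d) := (a :+ c) :+ (b :+ d)) refl
                                                                 (f zero) (g zero) (Σᶠ (f ∘ suc)) (Σᶠ (g ∘ suc)) ⟩
  (f zero + Σᶠ (f ∘ suc)) + (g zero + Σᶠ (g ∘ suc))    ∎
  where open ≡-Reasoning

Σᶠ-distribʳ-* : ∀ {n} (f : Fin n → ℚ) c → Σᶠ (λ x → f x * c) ≡ Σᶠ f * c
Σᶠ-distribʳ-* {ℕ.zero} f c = sym (ℚ.*-zeroˡ c)
Σᶠ-distribʳ-* {ℕ.suc n} f c =
  trans (cong (f zero * c +_) (Σᶠ-distribʳ-* (f ∘ suc) c)) (sym (ℚ.*-distribʳ-+ c (f zero) (Σᶠ (f ∘ suc))))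

term≤Σᶠ : ∀ {n} {f : Fin n → ℚ} → (∀ x → 0ℚ ≤ f x) → ∀ y → f y ≤ Σᶠ f
term≤Σᶠ {ℕ.suc n} {f} 0≤f zero =
  subst (_≤ Σᶠ f) (ℚ.+-identityʳ (f zero)) (ℚ.+-monoʳ-≤ (f zero) (Σᶠ-nonNeg (0≤f ∘ suc)))
term≤Σᶠ {ℕ.suc n} {f} 0≤f (suc y) = ℚ.≤-trans (term≤Σᶠ (0≤f ∘ suc) y)
  (subst (_≤ Σᶠ f) (ℚ.+-identityˡ (Σᶠ (f ∘ suc))) (ℚ.+-monoˡ-≤ (Σᶠ (f ∘ suc)) (0≤f zero)))

Σᶠ-single : ∀ {n} {f : Fin n → ℚ} c → (∀ x → x ≢ c → f x ≡ 0ℚ) → Σᶠ f ≡ f c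
Σᶠ-single {ℕ.suc n} {f} zero vanish =
  trans (cong (f zero +_) (trans (Σᶠ-cong (λ x → vanish (suc x) λ ())) (Σᶠ-0 n))) (ℚ.+-identityʳ (f zero))
Σᶠ-single {ℕ.suc n} {f} (suc c) vanish =
  trans (cong₂ _+_ (vanish zero λ ()) (Σᶠ-single c (λ x x≢c → vanish (suc x) (x≢c ∘ suc-injective))))
        (ℚ.+-identityˡ (f (suc c)))

𝔼 : ∀ {n} → Dist n → (Fin n → ℚ) → ℚ
𝔼 d r = Σᶠ (λ x → proj₁ d x * r x)

InUnitInterval : ℚ → Set
InUnitInterval q = 0ℚ ≤ q × q ≤ 1ℚ

module _ {n : ℕ} (d : Dist n) where

  private
    P = proj₁ d

    P-nonNeg : ∀ x → 0ℚ ≤ P x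
    P-nonNeg = proj₁ (proj₂ d)

    ΣP≡1 : Σᶠ P ≡ 1ℚ
    ΣP≡1 = proj₂ (proj₂ d)

  prob≤1 : ∀ x → P x ≤ 1ℚ
  prob≤1 x = subst (P x ≤_) ΣP≡1 (term≤Σᶠ P-nonNeg x)

  support-nonempty : ∃[ x ] 0ℚ < P x
  support-nonempty = search P-nonNeg ΣP≡1
    where
    search : ∀ {k} {f : Fin k → ℚ} → (∀ x → 0ℚ ≤ f x) → Σᶠ f ≡ 1ℚ → ∃[ x ] 0ℚ < f x
    search {ℕ.zero} _ ()
    search {ℕ.suc k} {f} 0≤f Σf≡1 with 0ℚ <? f zero
    ... | yes 0<f₀ = zero , 0<f₀
    ... | no  0≮f₀ = let x , 0<fx = search (0≤f ∘ suc) Σf∘suc≡1 in suc x , 0<fx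
      where
      open ≡-Reasoning
      Σf∘suc≡1 : Σᶠ (f ∘ suc) ≡ 1ℚ
      Σf∘suc≡1 = begin
        Σᶠ (f ∘ suc)          ≡⟨ ℚ.+-identityˡ _ ⟨
        0ℚ + Σᶠ (f ∘ suc)     ≡⟨ cong (_+ Σᶠ (f ∘ suc)) (nonNeg∧¬pos⇒≡0 (0≤f zero) 0≮f₀) ⟨
        f zero + Σᶠ (f ∘ suc) ≡⟨ Σf≡1 ⟩
        1ℚ                    ∎

  𝔼-cong-support : ∀ {r r′} → (∀ x → 0ℚ < P x → r x ≡ r′ x) → 𝔼 d r ≡ 𝔼 d r′
  𝔼-cong-support {r} {r′} r≗r′ = Σᶠ-cong termwise
    where
    termwise : ∀ x → P x * r x ≡ P x * r′ x
    termwise x with 0ℚ <? P x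
    ... | yes 0<Px = cong (P x *_) (r≗r′ x 0<Px)
    ... | no  0≮Px rewrite nonNeg∧¬pos⇒≡0 (P-nonNeg x) 0≮Px = trans (ℚ.*-zeroˡ (r x)) (sym (ℚ.*-zeroˡ (r′ x)))

  𝔼-const : ∀ c → 𝔼 d (λ _ → c) ≡ c
  𝔼-const c = trans (Σᶠ-distribʳ-* P c) (trans (cong (_* c) ΣP≡1) (ℚ.*-identityˡ c))

  𝔼-distrib-+ : ∀ r r′ → 𝔼 d (λ x → r x + r′ x) ≡ 𝔼 d r + 𝔼 d r′
  𝔼-distrib-+ r r′ =
    trans (Σᶠ-cong (λ x → ℚ.*-distribˡ-+ (P x) (r x) (r′ x))) (Σᶠ-distrib-+ (λ x → P x * r x) (λ x → P x * r′ x))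

  𝔼-inUnitInterval : ∀ {r} → (∀ x → InUnitInterval (r x)) → InUnitInterval (𝔼 d r)
  𝔼-inUnitInterval {r} r∈[0,1] =
    Σᶠ-nonNeg (λ x → *-nonNeg (P-nonNeg x) (proj₁ (r∈[0,1] x))) ,
    subst (𝔼 d r ≤_) ΣP≡1 (Σᶠ-mono-≤ λ x →
      subst (P x * r x ≤_) (ℚ.*-identityʳ (P x)) (ℚ.*-monoˡ-≤-nonNeg (P x) {{nonNegative (P-nonNeg x)}} (proj₂ (r∈[0,1] x))))

  1-𝔼≡𝔼1- : ∀ r → 1ℚ - 𝔼 d r ≡ 𝔼 d (λ x → 1ℚ - r x)
  1-𝔼≡𝔼1- r = begin
    1ℚ - 𝔼 d r                                      ≡⟨ cong (_- 𝔼 d r) (𝔼-const 1ℚ) ⟨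
    𝔼 d (λ _ → 1ℚ) - 𝔼 d r                          ≡⟨ cong (λ e → e - 𝔼 d r) (𝔼-cong-support (λ x _ → split (r x))) ⟩
    𝔼 d (λ x → r x + (1ℚ - r x)) - 𝔼 d r            ≡⟨ cong (_- 𝔼 d r) (𝔼-distrib-+ r (λ x → 1ℚ - r x)) ⟩
    (𝔼 d r + 𝔼 d (λ x → 1ℚ - r x)) - 𝔼 d r          ≡⟨ solve 2 (λ a b → (a :+ b) :- a := b) refl (𝔼 d r) _ ⟩
    𝔼 d (λ x → 1ℚ - r x)                            ∎
    where
    open ≡-Reasoning
    split : ∀ q → 1ℚ ≡ q + (1ℚ - q)
    split = solve 1 (λ q → con 1ℚ := q :+ (con 1ℚ :- q)) refl

  -- The deficit 1 - 𝔼 d r is a sum of nonnegative terms P x * (1 - r x), so it dominates each of them.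
  deficit≤𝔼-deficit : ∀ {r} → (∀ x → r x ≤ 1ℚ) → ∀ y → P y * (1ℚ - r y) ≤ 1ℚ - 𝔼 d r
  deficit≤𝔼-deficit {r} r≤1 y = subst (P y * (1ℚ - r y) ≤_) (sym (1-𝔼≡𝔼1- r))
    (term≤Σᶠ (λ x → *-nonNeg (P-nonNeg x) (p≤q⇒0≤q-p (r≤1 x))) y)

diracFn-self : ∀ {n} (c : Fin n) → diracFn c c ≡ 1ℚ
diracFn-self c with c ≟ c
... | yes _   = refl
... | no  c≢c = ⊥-elim (c≢c refl)

diracFn-other : ∀ {n} {c x : Fin n} → x ≢ c → diracFn c x ≡ 0ℚ
diracFn-other {c = c} {x} x≢c with c ≟ x
... | yes c≡x = ⊥-elim (x≢c (sym c≡x))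
... | no  _   = refl

diracFn-nonNeg : ∀ {n} (c x : Fin n) → 0ℚ ≤ diracFn c x
diracFn-nonNeg c x with c ≟ x
... | yes _ = 0≤1
... | no  _ = ℚ.≤-refl

dirac : ∀ {n} → Fin n → Dist n
dirac c = diracFn c , diracFn-nonNeg c , trans (Σᶠ-single c (λ _ → diracFn-other)) (diracFn-self c)

𝔼-dirac : ∀ {n} (c : Fin n) r → 𝔼 (dirac c) r ≡ r c
𝔼-dirac c r = begin
  𝔼 (dirac c) r     ≡⟨ Σᶠ-single c (λ x x≢c → trans (cong (_* r x) (diracFn-other x≢c)) (ℚ.*-zeroˡ (r x))) ⟩
  diracFn c c * r c ≡⟨ cong (_* r c) (diracFn-self c) ⟩
  1ℚ * r c          ≡⟨ ℚ.*-identityˡ (r c) ⟩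
  r c               ∎
  where open ≡-Reasoning

∀∃⇒∃∀ : ∀ {k} (P : ℕ → Fin k → Set) → (∀ {m n} x → m ℕ.≤ n → P m x → P n x) →
        (∀ x → ∃[ n ] P n x) → ∃[ n ] (∀ x → P n x)
∀∃⇒∃∀ {ℕ.zero} P mono bounded = 0 , λ ()
∀∃⇒∃∀ {ℕ.suc k} P mono bounded =
  let n₀ , P₀ = bounded zero
      n₁ , P₁ = ∀∃⇒∃∀ (λ n → P n ∘ suc) (mono ∘ suc) (bounded ∘ suc)
  in n₀ ⊔ n₁ , λ { zero → mono zero (m≤m⊔n n₀ n₁) P₀ ; (suc x) → mono (suc x) (m≤n⊔m n₀ n₁) (P₁ x) }

support-bound : ∀ {k} (d : Dist k) (P : ℕ → Fin k → Set) → (∀ {m n} x → m ℕ.≤ n → P m x → P n x) →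
                (∀ x → 0ℚ < proj₁ d x → ∃[ n ] P n x) → ∃[ n ] (∀ x → 0ℚ < proj₁ d x → P n x)
support-bound d P mono bounded =
  ∀∃⇒∃∀ (λ n x → 0ℚ < proj₁ d x → P n x) (λ x m≤n Pₘ → mono x m≤n ∘ Pₘ) boundedOrOutside
  where
  boundedOrOutside : ∀ x → ∃[ n ] (0ℚ < proj₁ d x → P n x)
  boundedOrOutside x with 0ℚ <? proj₁ d x
  ... | yes 0<dx = let n , Pₙ = bounded x 0<dx in n , λ _ → Pₙ
  ... | no  0≮dx = 0 , λ 0<dx → ⊥-elim (0≮dx 0<dx)

-- ReachesSurely M T σ unfolds to TendsToOne (PrWithin M T σ).
TendsToOne : (ℕ → ℚ) → Set
TendsToOne x = ∀ ε → 0ℚ < ε → ∃[ n ] (1ℚ - ε ≤ x n)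

tendsToOne-transfer : ∀ {x y : ℕ → ℚ} {c} → 0ℚ < c → (∀ n → ∃[ m ] (c * (1ℚ - y m) ≤ 1ℚ - x n)) →
                      TendsToOne x → TendsToOne y
tendsToOne-transfer {x} {y} {c} 0<c dominated x→1 ε 0<ε =
  let n , 1-cε≤xₙ = x→1 (c * ε) (*-pos 0<c 0<ε)
      m , c[1-yₘ]≤1-xₙ = dominated n
  in m , p-r≤q⇒p-q≤r {1ℚ} {ε} {y m} (ℚ.*-cancelˡ-≤-pos c {{positive 0<c}}
           (ℚ.≤-trans c[1-yₘ]≤1-xₙ (p-r≤q⇒p-q≤r {1ℚ} {x n} {c * ε} 1-cε≤xₙ)))

¬tendsToOne-0 : ∀ {x : ℕ → ℚ} → (∀ n → x n ≡ 0ℚ) → ¬ TendsToOne x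
¬tendsToOne-0 x≡0 x→1 = let n , 1-½≤xₙ = x→1 ½ (ℚ.positive⁻¹ ½) in 1-½≰0 (subst (1ℚ - ½ ≤_) (x≡0 n) 1-½≤xₙ)

≡1⇒tendsToOne : ∀ {x : ℕ → ℚ} n → x n ≡ 1ℚ → TendsToOne x
≡1⇒tendsToOne n xₙ≡1 ε 0<ε = n , subst (1ℚ - ε ≤_) (sym xₙ≡1) (1-p≤1 (ℚ.<⇒≤ 0<ε))

supportChoice : ∀ {nS nA} → Policy nS nA → History nS nA → Fin nA
supportChoice σ h = proj₁ (support-nonempty (σ h))

supportChoice-inSupport : ∀ {nS nA} (σ : Policy nS nA) h → 0ℚ < proj₁ (σ h) (supportChoice σ h)
supportChoice-inSupport σ h = proj₂ (support-nonempty (σ h))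

module _ {nS nA : ℕ} (M : MDP nS nA) where
  open MDP M

  Transient : Fin nS → Set
  Transient s = ∀ t → Succ M s t → ¬ Reach M t s

  -- Strictly downstream of a transient state: irreflexive by transience, so well-founded on Fin nS.
  _⊏_ : Fin nS → Fin nS → Set
  t ⊏ s = Transient s × ∃[ u ] (Succ M s u × Reach M u t)

  Reach-trans : ∀ {s t u} → Reach M s t → Reach M t u → Reach M s u
  Reach-trans here               t↝u = t↝u
  Reach-trans (step s→s′ s′↝t) t↝u = step s→s′ (Reach-trans s′↝t t↝u)

  ⊏-isStrictPartialOrder : IsStrictPartialOrder _≡_ _⊏_
  ⊏-isStrictPartialOrder = record
    { isEquivalence = isEquivalence
    ; irrefl        = λ { refl (transient , u , s→u , u↝s) → transient u s→u u↝s }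
    ; trans         = λ { (_ , v , t→v , v↝s) (transient , w , u→w , w↝t) →
                            transient , w , u→w , Reach-trans w↝t (step t→v v↝s) }
    ; <-resp-≈      = (λ { refl t⊏s → t⊏s }) , (λ { refl t⊏s → t⊏s })
    }

  ⊏-wellFounded : WellFounded _⊏_
  ⊏-wellFounded = spo-wellFounded ⊏-isStrictPartialOrder

  module _ (T : Subset nS) where

    module _ (σ : Policy nS nA) where

      reachWithin-∈ : ∀ {n h} → proj₂ h ∈ T → reachWithin M T σ n h ≡ 1ℚ
      reachWithin-∈ {h = h} h∈T with proj₂ h ∈? T
      ... | yes _   = refl
      ... | no  h∉T = ⊥-elim (h∉T h∈T)

      reachWithin-∉-zero : ∀ {h} → proj₂ h ∉ T → reachWithin M T σ 0 h ≡ 0ℚ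
      reachWithin-∉-zero {h} h∉T with proj₂ h ∈? T
      ... | yes h∈T = ⊥-elim (h∉T h∈T)
      ... | no  _   = refl

      reachWithin-∉-suc : ∀ {n h} → proj₂ h ∉ T → reachWithin M T σ (ℕ.suc n) h ≡
        𝔼 (σ h) (λ a → 𝔼 (p (proj₂ h) a) (λ s′ → reachWithin M T σ n (extend h a s′)))
      reachWithin-∉-suc {h = h} h∉T with proj₂ h ∈? T
      ... | yes h∈T = ⊥-elim (h∉T h∈T)
      ... | no  _   = refl

      reachWithin-inUnitInterval : ∀ n h → InUnitInterval (reachWithin M T σ n h)
      reachWithin-inUnitInterval n h with proj₂ h ∈? T
      reachWithin-inUnitInterval n       h | yes _ = 0≤1 , ℚ.≤-refl
      reachWithin-inUnitInterval ℕ.zero  h | no  _ = ℚ.≤-refl , 0≤1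
      reachWithin-inUnitInterval (ℕ.suc n) h | no  _ =
        𝔼-inUnitInterval (σ h) λ a → 𝔼-inUnitInterval (p (proj₂ h) a) λ s′ →
          reachWithin-inUnitInterval n (extend h a s′)

      reachWithin≤1 : ∀ n h → reachWithin M T σ n h ≤ 1ℚ
      reachWithin≤1 n h = proj₂ (reachWithin-inUnitInterval n h)

      deficit-step : ∀ {n h} a s′ → proj₂ h ∉ T →
        (proj₁ (σ h) a * proj₁ (p (proj₂ h) a) s′) * (1ℚ - reachWithin M T σ n (extend h a s′))
          ≤ 1ℚ - reachWithin M T σ (ℕ.suc n) h
      deficit-step {n} {h} a s′ h∉T = begin
        (σₕ a * pₐ s′) * (1ℚ - R n (extend h a s′)) ≡⟨ ℚ.*-assoc (σₕ a) (pₐ s′) _ ⟩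
        σₕ a * (pₐ s′ * (1ℚ - R n (extend h a s′))) ≤⟨ ℚ.*-monoˡ-≤-nonNeg (σₕ a) {{nonNegative (proj₁ (proj₂ (σ h)) a)}}
                                                         (deficit≤𝔼-deficit (p (proj₂ h) a) (λ s″ → reachWithin≤1 n (extend h a s″)) s′) ⟩
        σₕ a * (1ℚ - afterAction a)                 ≤⟨ deficit≤𝔼-deficit (σ h) afterAction≤1 a ⟩
        1ℚ - 𝔼 (σ h) afterAction                    ≡⟨ cong (λ r → 1ℚ - r) (reachWithin-∉-suc h∉T) ⟨
        1ℚ - R (ℕ.suc n) h                          ∎
        where
        open ℚ.≤-Reasoning
        R = reachWithin M T σ
        σₕ = proj₁ (σ h)
        pₐ = proj₁ (p (proj₂ h) a)
        afterAction : Fin nA → ℚ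
        afterAction b = 𝔼 (p (proj₂ h) b) (λ s″ → R n (extend h b s″))
        afterAction≤1 : ∀ b → afterAction b ≤ 1ℚ
        afterAction≤1 b = proj₂ (𝔼-inUnitInterval (p (proj₂ h) b) (λ s″ → reachWithin-inUnitInterval n (extend h b s″)))

      reachWithin-absorbing : ∀ {s} → Absorbing M s → s ∉ T → ∀ n h → proj₂ h ≡ s → reachWithin M T σ n h ≡ 0ℚ
      reachWithin-absorbing absorbing s∉T ℕ.zero h refl = reachWithin-∉-zero s∉T
      reachWithin-absorbing {s} absorbing s∉T (ℕ.suc n) h refl = begin
        reachWithin M T σ (ℕ.suc n) h                                        ≡⟨ reachWithin-∉-suc s∉T ⟩
        𝔼 (σ h) (λ a → 𝔼 (p s a) (λ s′ → reachWithin M T σ n (extend h a s′))) ≡⟨ 𝔼-cong-support (σ h) (λ a _ → stuck a) ⟩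
        𝔼 (σ h) (λ _ → 0ℚ)                                                   ≡⟨ 𝔼-const (σ h) 0ℚ ⟩
        0ℚ                                                                   ∎
        where
        open ≡-Reasoning
        stuck : ∀ a → 𝔼 (p s a) (λ s′ → reachWithin M T σ n (extend h a s′)) ≡ 0ℚ
        stuck a = trans (𝔼-cong-support (p s a) (λ s′ 0<ps′ →
                    reachWithin-absorbing absorbing s∉T n (extend h a s′) (absorbing s′ (step (a , 0<ps′) here))))
                  (𝔼-const (p s a) 0ℚ)

      AlmostSurelyFrom : History nS nA → Set
      AlmostSurelyFrom h = TendsToOne (λ n → reachWithin M T σ n h)

      almostSurelyFrom-initial : ReachesSurely M T σ → ∀ {s} → 0ℚ < proj₁ ι s → AlmostSurelyFrom ([] , s)
      almostSurelyFrom-initial σ-sure {s} 0<ιs = tendsToOne-transfer 0<ιs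
        (λ n → n , deficit≤𝔼-deficit ι (λ s′ → reachWithin≤1 n ([] , s′)) s) σ-sure

      almostSurelyFrom-extend : ∀ {h a s′} → proj₂ h ∉ T → 0ℚ < proj₁ (σ h) a → 0ℚ < proj₁ (p (proj₂ h) a) s′ →
                                AlmostSurelyFrom h → AlmostSurelyFrom (extend h a s′)
      almostSurelyFrom-extend {h} {a} {s′} h∉T 0<σa 0<ps′ = tendsToOne-transfer (*-pos 0<σa 0<ps′) dominated
        where
        c = proj₁ (σ h) a * proj₁ (p (proj₂ h) a) s′
        R = reachWithin M T σ

        c≤1 : c ≤ 1ℚ
        c≤1 = *-≤1 (ℚ.<⇒≤ 0<σa) (prob≤1 (σ h) a) (prob≤1 (p (proj₂ h) a) s′)

        dominated : ∀ n → ∃[ m ] (c * (1ℚ - R m (extend h a s′)) ≤ 1ℚ - R n h)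
        dominated ℕ.zero = 0 , subst (λ r → c * (1ℚ - R 0 (extend h a s′)) ≤ 1ℚ - r) (sym (reachWithin-∉-zero h∉T))
          (*-≤1 (*-nonNeg (ℚ.<⇒≤ 0<σa) (ℚ.<⇒≤ 0<ps′)) c≤1 (1-p≤1 (proj₁ (reachWithin-inUnitInterval 0 (extend h a s′)))))
        dominated (ℕ.suc n) = n , deficit-step a s′ h∉T

      ¬almostSurelyFrom-absorbing : ∀ {h} → Absorbing M (proj₂ h) → proj₂ h ∉ T → ¬ AlmostSurelyFrom h
      ¬almostSurelyFrom-absorbing {h} absorbing h∉T = ¬tendsToOne-0 (λ n → reachWithin-absorbing absorbing h∉T n h refl)

    module _ (f : History nS nA → Fin nA) where

      data SurelyWithin : ℕ → History nS nA → Set where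
        reached : ∀ {n h} → proj₂ h ∈ T → SurelyWithin n h
        next    : ∀ {n h} → (∀ s′ → 0ℚ < proj₁ (p (proj₂ h) (f h)) s′ → SurelyWithin n (extend h (f h) s′)) →
                  SurelyWithin (ℕ.suc n) h

      SurelyWithin-mono : ∀ {m n h} → m ℕ.≤ n → SurelyWithin m h → SurelyWithin n h
      SurelyWithin-mono _         (reached h∈T) = reached h∈T
      SurelyWithin-mono (s≤s m≤n) (next sure)   = next (λ s′ 0<ps′ → SurelyWithin-mono m≤n (sure s′ 0<ps′))

      SurelyWithin⇒reachWithin≡1 : ∀ {n h} → SurelyWithin n h → reachWithin M T (dirac ∘ f) n h ≡ 1ℚ
      SurelyWithin⇒reachWithin≡1 (reached h∈T) = reachWithin-∈ (dirac ∘ f) h∈T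
      SurelyWithin⇒reachWithin≡1 {ℕ.suc n} {h} (next sure) with proj₂ h ∈? T
      ... | yes _ = refl
      ... | no  _ = begin
        𝔼 (dirac (f h)) (λ a → 𝔼 (p (proj₂ h) a) (λ s′ → R n (extend h a s′))) ≡⟨ 𝔼-dirac (f h) _ ⟩
        𝔼 (p (proj₂ h) (f h)) (λ s′ → R n (extend h (f h) s′))              ≡⟨ 𝔼-cong-support (p (proj₂ h) (f h))
                                                                                (λ s′ 0<ps′ → SurelyWithin⇒reachWithin≡1 (sure s′ 0<ps′)) ⟩
        𝔼 (p (proj₂ h) (f h)) (λ _ → 1ℚ)                                     ≡⟨ 𝔼-const (p (proj₂ h) (f h)) 1ℚ ⟩
        1ℚ                                                                   ∎
        where
        open ≡-Reasoning
        R = reachWithin M T (dirac ∘ f)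

      SurelyWithin⇒PrWithin≡1 : ∀ {n} → (∀ s → 0ℚ < proj₁ ι s → SurelyWithin n ([] , s)) → PrWithin M T (dirac ∘ f) n ≡ 1ℚ
      SurelyWithin⇒PrWithin≡1 sure =
        trans (𝔼-cong-support ι (λ s 0<ιs → SurelyWithin⇒reachWithin≡1 (sure s 0<ιs))) (𝔼-const ι 1ℚ)

    module _ (acyclic : AcyclicMDP M) (σ : Policy nS nA) where

      almostSurelyFrom⇒surelyWithin : ∀ h → Acc _⊏_ (proj₂ h) → AlmostSurelyFrom σ h →
                                      ∃[ n ] SurelyWithin (supportChoice σ) n h
      almostSurelyFrom⇒surelyWithin h (acc rec) h-almostSure = cases (proj₂ h ∈? T) (acyclic (proj₂ h))
        where
        a = supportChoice σ h

        cases : Dec (proj₂ h ∈ T) → Absorbing M (proj₂ h) ⊎ Transient (proj₂ h) →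
                ∃[ n ] SurelyWithin (supportChoice σ) n h
        cases (yes h∈T) _              = 0 , reached h∈T
        cases (no  h∉T) (inj₁ absorbing) = ⊥-elim (¬almostSurelyFrom-absorbing σ absorbing h∉T h-almostSure)
        cases (no  h∉T) (inj₂ transient) =
          let n , sure = support-bound (p (proj₂ h) a) (λ n s′ → SurelyWithin (supportChoice σ) n (extend h a s′))
                           (λ _ → SurelyWithin-mono (supportChoice σ)) fromSuccessor
          in ℕ.suc n , next sure
          where
          fromSuccessor : ∀ s′ → 0ℚ < proj₁ (p (proj₂ h) a) s′ → ∃[ n ] SurelyWithin (supportChoice σ) n (extend h a s′)
          fromSuccessor s′ 0<ps′ = almostSurelyFrom⇒surelyWithin (extend h a s′) (rec (transient , s′ , (a , 0<ps′) , here))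
            (almostSurelyFrom-extend σ h∉T (supportChoice-inSupport σ h) 0<ps′ h-almostSure)

      supportChoice-reachesSurely : ReachesSurely M T σ → ReachesSurely M T (dirac ∘ supportChoice σ)
      supportChoice-reachesSurely σ-sure =
        let n , sure = support-bound ι (λ n s → SurelyWithin (supportChoice σ) n ([] , s))
                         (λ _ → SurelyWithin-mono (supportChoice σ)) fromInitial
        in ≡1⇒tendsToOne {PrWithin M T (dirac ∘ supportChoice σ)} n (SurelyWithin⇒PrWithin≡1 (supportChoice σ) sure)
        where
        fromInitial : ∀ s → 0ℚ < proj₁ ι s → ∃[ n ] SurelyWithin (supportChoice σ) n ([] , s)
        fromInitial s 0<ιs = almostSurelyFrom⇒surelyWithin ([] , s) (⊏-wellFounded s) (almostSurelyFrom-initial σ σ-sure 0<ιs)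

lemma12 : ∀ {nS nA nI : ℕ} (N : MEMDP nS nA nI) → AcyclicMEMDP N → (T : Subset nS)
    → Σ (Policy nS nA) (λ σ → ∀ (i : Fin nI) → ReachesSurely (MEMDP.env N i) T σ)
    → Σ (Policy nS nA) (λ σ → Deterministic σ × (∀ (i : Fin nI) → ReachesSurely (MEMDP.env N i) T σ))
lemma12 N acyclic T (σ , σ-sure) =
  dirac ∘ supportChoice σ ,
  (supportChoice σ , λ _ _ → refl) ,
  λ i → supportChoice-reachesSurely (MEMDP.env N i) T (acyclic i) σ (σ-sure i)
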